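{- Let $G$ be a maximal outerplane graph and let $S$ be a general position set of $G$ with $|S|\geq 3$. If $x\in S$, then $|N_G(x)\cap S|\leq 2$.
   Context: All graphs are finite, simple, undirected and connected. A set $R\subseteq V(G)$ is a general position set of $G$ if no three distinct vertices of $R$ are such that one of them lies on a shortest path (geodesic) in $G$ between the other two. A maximal outerplane graph is a maximal outerplanar graph (an outerplanar graph to which no edge can be added preserving outerplanarity) embedded in the plane with all vertices on the outer face. $N_G(x)$ is the set of neighbours of $x$ in $G$. -}

module Defs where

open import Data.Nat using (ℕ; zero; suc; _<_; _≤_)
open import Data.Fin using (Fin; _≟_)
open import Data.Fin.Subset using (Subset; _∈_; _∩_; ∣_∣)
open import Data.Bool using (Bool; true; false; _∨_)
open import Data.Vec using (tabulate)
open import Data.Product using (Σ; _×_; ∃)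
open import Relation.Nullary using (¬_; ⌊_⌋)
open import Relation.Binary.PropositionalEquality using (_≡_; _≢_)
open import Function.Definitions using (Injective)
import Data.Fin
import Data.Bool
import Data.Bool.Properties
import Data.Empty
import Relation.Nullary
import Relation.Binary.PropositionalEquality

record Graph (n : ℕ) : Set where
  field
    adj   : Fin n → Fin n → Bool
    sym   : ∀ u v → adj u v ≡ adj v u
    irrefl : ∀ v → adj v v ≡ false
open Graph public

Adj : ∀ {n} → Graph n → Fin n → Fin n → Set
Adj G u v = adj G u v ≡ true

data Walk {n} (G : Graph n) : Fin n → Fin n → ℕ → Set where
  [_]  : ∀ v → Walk G v v zero
  _∷_  : ∀ {u w v k} → Adj G u w → Walk G w v k → Walk G u v (suc k)

data OnWalk {n} {G : Graph n} (z : Fin n) : ∀ {u v k} → Walk G u v k → Set where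
  here-end : OnWalk z ([ z ])
  here     : ∀ {w v k} (e : Adj G z w) (p : Walk G w v k) → OnWalk z (e ∷ p)
  there    : ∀ {u w v k} (e : Adj G u w) {p : Walk G w v k} → OnWalk z p → OnWalk z (e ∷ p)

Connected : ∀ {n} → Graph n → Set
Connected G = ∀ u v → ∃ λ k → Walk G u v k

IsGeodesic : ∀ {n} {G : Graph n} {u v k} → Walk G u v k → Set
IsGeodesic {G = G} {u} {v} {k} _ = ∀ k' → Walk G u v k' → k ≤ k'

OnGeodesic : ∀ {n} → Graph n → Fin n → Fin n → Fin n → Set
OnGeodesic G z u v = Σ ℕ λ k → Σ (Walk G u v k) λ w → IsGeodesic w × OnWalk z w

GeneralPosition : ∀ {n} → Graph n → Subset n → Set
GeneralPosition G S = ∀ u v w → u ∈ S → v ∈ S → w ∈ S →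
  u ≢ v → v ≢ w → u ≢ w → ¬ OnGeodesic G v u w

-- Outerplanarity via the standard combinatorial characterisation (one-page book
-- embedding): vertices can be placed in a cyclic order on a circle (pos gives the
-- position of each vertex) so that no two edges cross as chords.
Crossing : ∀ {n} → (Fin n → Fin n) → Fin n → Fin n → Fin n → Fin n → Set
Crossing pos a b c d =
  Data.Fin._<_ (pos a) (pos c) × Data.Fin._<_ (pos c) (pos b) × Data.Fin._<_ (pos b) (pos d)

Outerplanar : ∀ {n} → Graph n → Set
Outerplanar {n} G = Σ (Fin n → Fin n) λ pos → Injective _≡_ _≡_ pos ×
  (∀ a b c d → Adj G a b → Adj G c d → ¬ Crossing pos a b c d)

addEdge : ∀ {n} → Graph n → (u v : Fin n) → u ≢ v → Graph n
addEdge {n} G u v u≢v = record { adj = a ; sym = s ; irrefl = i }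
  where
  isUV : Fin n → Fin n → Bool
  isUV x y = (⌊ x ≟ u ⌋ Data.Bool.∧ ⌊ y ≟ v ⌋) ∨ (⌊ x ≟ v ⌋ Data.Bool.∧ ⌊ y ≟ u ⌋)
  a : Fin n → Fin n → Bool
  a x y = adj G x y ∨ isUV x y
  s : ∀ x y → a x y ≡ a y x
  s x y rewrite sym G x y | Data.Bool.Properties.∨-comm (⌊ x ≟ u ⌋ Data.Bool.∧ ⌊ y ≟ v ⌋) (⌊ x ≟ v ⌋ Data.Bool.∧ ⌊ y ≟ u ⌋)
              | Data.Bool.Properties.∧-comm ⌊ x ≟ v ⌋ ⌊ y ≟ u ⌋
              | Data.Bool.Properties.∧-comm ⌊ x ≟ u ⌋ ⌊ y ≟ v ⌋ = Relation.Binary.PropositionalEquality.refl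
  i : ∀ x → a x x ≡ false
  i x rewrite irrefl G x with x ≟ u | x ≟ v
  ... | Relation.Nullary.yes Relation.Binary.PropositionalEquality.refl | Relation.Nullary.yes Relation.Binary.PropositionalEquality.refl = Data.Empty.⊥-elim (u≢v Relation.Binary.PropositionalEquality.refl)
  ... | Relation.Nullary.yes _ | Relation.Nullary.no _ = Relation.Binary.PropositionalEquality.refl
  ... | Relation.Nullary.no _ | Relation.Nullary.yes _ = Relation.Binary.PropositionalEquality.refl
  ... | Relation.Nullary.no _ | Relation.Nullary.no _ = Relation.Binary.PropositionalEquality.refl

MaximalOuterplanar : ∀ {n} → Graph n → Set
MaximalOuterplanar G = Outerplanar G ×
  (∀ u v (u≢v : u ≢ v) → adj G u v ≡ false → ¬ Outerplanar (addEdge G u v u≢v))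

N : ∀ {n} → Graph n → Fin n → Subset n
N G x = tabulate (adj G x)

{-# OPTIONS --safe #-}
-- If x ∈ S had three neighbours a, b, c in S, they would be pairwise adjacent: were a and b
-- non-adjacent, a – x – b would be a geodesic through x. Then x, a, b, c span a K₄, and K₄ is
-- not outerplanar, because whatever order four vertices take on the circle, the two diagonals
-- cross.
module Submission where

open import Defs
open import Data.Nat using (ℕ; _≤_)
open import Data.Fin using (Fin)
open import Data.Fin.Subset using (Subset; _∈_; _∩_; ∣_∣)

open import Data.Bool using (true; false)
open import Data.Empty using (⊥)
open import Data.Fin using (zero; suc) renaming (_<_ to _<ᶠ_)
open import Data.Fin.Patterns using (0F; 1F; 2F)
open import Data.Fin.Properties using (suc-injective; <-cmp; <-trans; <-irrefl)
open import Data.Fin.Subset using (inside; outside)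
open import Data.Fin.Subset.Properties using (x∈p∩q⁻)
open import Data.Nat using (zero; suc; _<_; s≤s; z≤n)
open import Data.Nat.Properties using (≮⇒≥)
open import Data.Product using (Σ; _×_; _,_; proj₁; proj₂)
open import Data.Sum using (_⊎_; inj₁; inj₂)
open import Data.Vec using (_∷_; []; here; there)
open import Data.Vec.Properties using (lookup∘tabulate; []=⇒lookup)
open import Function using (_∘_)
open import Function.Definitions using (Injective)
open import Relation.Binary using (tri<; tri≈; tri>)
open import Relation.Binary.PropositionalEquality as ≡ using (_≡_; _≢_; refl; cong)
open import Relation.Nullary using (¬_; contradiction)

k≤∣p∣⇒injection : ∀ {n k} (p : Subset n) → k ≤ ∣ p ∣ →
  Σ (Fin k → Fin n) λ f → Injective _≡_ _≡_ f × (∀ i → f i ∈ p)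
k≤∣p∣⇒injection {k = zero} p _ = (λ ()) , (λ { {()} }) , λ ()
k≤∣p∣⇒injection {k = suc k} (inside ∷ p) (s≤s k≤∣p∣) with k≤∣p∣⇒injection p k≤∣p∣
... | f , f-inj , f∈p = g , g-inj , g∈
  where
  g : Fin (suc k) → Fin _
  g zero    = zero
  g (suc i) = suc (f i)
  g-inj : Injective _≡_ _≡_ g
  g-inj {zero}  {zero}  _  = refl
  g-inj {suc i} {suc j} eq = cong suc (f-inj (suc-injective eq))
  g∈ : ∀ i → g i ∈ inside ∷ p
  g∈ zero    = here
  g∈ (suc i) = there (f∈p i)
k≤∣p∣⇒injection {k = suc k} (outside ∷ p) k≤∣p∣ with k≤∣p∣⇒injection p k≤∣p∣
... | f , f-inj , f∈p = suc ∘ f , f-inj ∘ suc-injective , there ∘ f∈p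

module _ {n} (G : Graph n) where

  Adj-sym : ∀ {u v} → Adj G u v → Adj G v u
  Adj-sym {u} {v} uv = ≡.trans (Graph.sym G v u) uv

  Adj⇒≢ : ∀ {u v} → Adj G u v → u ≢ v
  Adj⇒≢ {u} uu refl = contradiction (≡.trans (≡.sym uu) (irrefl G u)) λ ()

  ∈N⇒Adj : ∀ {x v} → v ∈ N G x → Adj G x v
  ∈N⇒Adj {x} {v} v∈N = ≡.trans (≡.sym (lookup∘tabulate (adj G x) v)) ([]=⇒lookup v∈N)

  ∈N∩⇒Adj : ∀ {x v} T → v ∈ N G x ∩ T → Adj G x v
  ∈N∩⇒Adj {x} T v∈ = ∈N⇒Adj (proj₁ (x∈p∩q⁻ (N G x) T v∈))

  nonadjacent⇒length-two-geodesic : ∀ {u v} → u ≢ v → adj G u v ≡ false →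
    (p : Walk G u v 2) → IsGeodesic p
  nonadjacent⇒length-two-geodesic u≢v _     _ _ [ _ ]          = contradiction refl u≢v
  nonadjacent⇒length-two-geodesic _   ¬u~v _ _ (u~v ∷ [ _ ])   = contradiction (≡.trans (≡.sym u~v) ¬u~v) λ ()
  nonadjacent⇒length-two-geodesic _   _    _ _ (_ ∷ _ ∷ _)     = s≤s (s≤s z≤n)

  generalPosition⇒neighbours-adjacent : ∀ {S x u v} → GeneralPosition G S →
    x ∈ S → u ∈ S → v ∈ S → Adj G x u → Adj G x v → u ≢ v → Adj G u v
  generalPosition⇒neighbours-adjacent {x = x} {u} {v} gp x∈S u∈S v∈S x~u x~v u≢v with adj G u v in adj-uv
  ... | true  = refl
  ... | false = contradiction (2 , path , nonadjacent⇒length-two-geodesic u≢v adj-uv path , x∈path)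
                  (gp _ _ _ u∈S x∈S v∈S (Adj⇒≢ (Adj-sym x~u)) (Adj⇒≢ x~v) u≢v)
    where
    path : Walk G u v 2
    path = Adj-sym x~u ∷ x~v ∷ [ v ]
    x∈path : OnWalk x path
    x∈path = there (Adj-sym x~u) (here x~v [ v ])

Clique : ∀ {n} → Graph n → (Fin n → Set) → Set
Clique {n} G K = ∀ {u v} → K u → K v → u ≢ v → Adj G u v

module _ {n} (G : Graph n) (outerplanar : Outerplanar G) {K : Fin n → Set} (clique : Clique G K) where

  private
    pos : Fin n → Fin n
    pos = proj₁ outerplanar

    _≺_ : Fin n → Fin n → Set
    u ≺ v = pos u <ᶠ pos v

    ≺⇒≢ : ∀ {u v} → u ≺ v → u ≢ v
    ≺⇒≢ u≺v refl = <-irrefl refl u≺v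

    ≢⇒≺⊎≻ : ∀ {u v} → u ≢ v → u ≺ v ⊎ v ≺ u
    ≢⇒≺⊎≻ {u} {v} u≢v with <-cmp (pos u) (pos v)
    ... | tri< u≺v _ _ = inj₁ u≺v
    ... | tri≈ _ eq _  = contradiction (proj₁ (proj₂ outerplanar) eq) u≢v
    ... | tri> _ _ v≺u = inj₂ v≺u

    -- An insertion sort by position: sorted₂ places c among a ≺ b, sorted₃ places d among a ≺ b ≺ c.
    sorted₄ : ∀ {a b c d} → K a → K b → K c → K d → a ≺ b → b ≺ c → c ≺ d → ⊥
    sorted₄ {a} {b} {c} {d} ka kb kc kd a≺b b≺c c≺d =
      proj₂ (proj₂ outerplanar) a c b d
        (clique ka kc (≺⇒≢ (<-trans a≺b b≺c))) (clique kb kd (≺⇒≢ (<-trans b≺c c≺d)))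
        (a≺b , b≺c , c≺d)

    sorted₃ : ∀ {a b c d} → K a → K b → K c → K d → a ≺ b → b ≺ c →
      d ≢ a → d ≢ b → d ≢ c → ⊥
    sorted₃ ka kb kc kd a≺b b≺c d≢a d≢b d≢c with ≢⇒≺⊎≻ d≢a
    ... | inj₁ d≺a = sorted₄ kd ka kb kc d≺a a≺b b≺c
    ... | inj₂ a≺d with ≢⇒≺⊎≻ d≢b
    ...   | inj₁ d≺b = sorted₄ ka kd kb kc a≺d d≺b b≺c
    ...   | inj₂ b≺d with ≢⇒≺⊎≻ d≢c
    ...     | inj₁ d≺c = sorted₄ ka kb kd kc a≺b b≺d d≺c
    ...     | inj₂ c≺d = sorted₄ ka kb kc kd a≺b b≺c c≺d

    sorted₂ : ∀ {a b c d} → K a → K b → K c → K d → a ≺ b →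
      c ≢ a → c ≢ b → d ≢ a → d ≢ b → d ≢ c → ⊥
    sorted₂ ka kb kc kd a≺b c≢a c≢b d≢a d≢b d≢c with ≢⇒≺⊎≻ c≢a
    ... | inj₁ c≺a = sorted₃ kc ka kb kd c≺a a≺b d≢c d≢a d≢b
    ... | inj₂ a≺c with ≢⇒≺⊎≻ c≢b
    ...   | inj₁ c≺b = sorted₃ ka kc kb kd a≺c c≺b d≢a d≢c d≢b
    ...   | inj₂ b≺c = sorted₃ ka kb kc kd a≺b b≺c d≢a d≢b d≢c

  outerplanar⇒K₄-free : ∀ {a b c d} → K a → K b → K c → K d →
    b ≢ a → c ≢ a → c ≢ b → d ≢ a → d ≢ b → d ≢ c → ⊥
  outerplanar⇒K₄-free ka kb kc kd b≢a c≢a c≢b d≢a d≢b d≢c with ≢⇒≺⊎≻ b≢a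
  ... | inj₁ b≺a = sorted₂ kb ka kc kd b≺a c≢b c≢a d≢b d≢a d≢c
  ... | inj₂ a≺b = sorted₂ ka kb kc kd a≺b c≢a c≢b d≢a d≢b d≢c

generalPosition⇒closedNeighbourhood-clique : ∀ {n} (G : Graph n) {S x} → GeneralPosition G S → x ∈ S →
  Clique G (λ v → v ≡ x ⊎ v ∈ N G x ∩ S)
generalPosition⇒closedNeighbourhood-clique G {S} {x} gp x∈S = clique
  where
  ∈S : ∀ {v} → v ∈ N G x ∩ S → v ∈ S
  ∈S v∈ = proj₂ (x∈p∩q⁻ (N G x) S v∈)
  clique : Clique G (λ v → v ≡ x ⊎ v ∈ N G x ∩ S)
  clique (inj₁ refl) (inj₁ refl) x≢x = contradiction refl x≢x
  clique (inj₁ refl) (inj₂ v∈)   _   = ∈N∩⇒Adj G S v∈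
  clique (inj₂ u∈)   (inj₁ refl) _   = Adj-sym G (∈N∩⇒Adj G S u∈)
  clique (inj₂ u∈)   (inj₂ v∈)   u≢v =
    generalPosition⇒neighbours-adjacent G gp x∈S (∈S u∈) (∈S v∈)
      (∈N∩⇒Adj G S u∈) (∈N∩⇒Adj G S v∈) u≢v

mainTheorem2 : ∀ {n} (G : Graph n) → Connected G → MaximalOuterplanar G →
    (S : Subset n) → GeneralPosition G S → 3 ≤ ∣ S ∣ →
    (x : Fin n) → x ∈ S → ∣ N G x ∩ S ∣ ≤ 2
mainTheorem2 G _ (outerplanar , _) S gp _ x x∈S = ≮⇒≥ no-three-neighbours
  where
  no-three-neighbours : ¬ 2 < ∣ N G x ∩ S ∣
  no-three-neighbours 3≤∣N∩S∣ with k≤∣p∣⇒injection (N G x ∩ S) 3≤∣N∩S∣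
  ... | f , f-inj , f∈ =
    outerplanar⇒K₄-free G outerplanar (generalPosition⇒closedNeighbourhood-clique G gp x∈S)
      (inj₁ refl) (inj₂ (f∈ 0F)) (inj₂ (f∈ 1F)) (inj₂ (f∈ 2F))
      (f≢x 0F) (f≢x 1F) (f-distinct λ ()) (f≢x 2F) (f-distinct λ ()) (f-distinct λ ())
    where
    f≢x : ∀ i → f i ≢ x
    f≢x i = Adj⇒≢ G (Adj-sym G (∈N∩⇒Adj G S (f∈ i)))
    f-distinct : ∀ {i j} → i ≢ j → f i ≢ f j
    f-distinct i≢j = i≢j ∘ f-inj
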